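{- Let $m$ be a positive integer and $\lambda$ a nonzero real number. For integers $n\ge k\ge0$, $$W_{m,\lambda}(n,k)=\sum_{i=k}^{n}\binom{n}{i}m^{i-k}(1)_{n-i,\lambda}\,S_{2,\lambda/m}(i,k).$$
   Context: For a nonzero real $\mu$: $(x)_{0,\mu}=1$, $(x)_{n,\mu}=x(x-\mu)\cdots(x-(n-1)\mu)$; $(x)_n=(x)_{n,1}$. Degenerate Stirling numbers of the second kind: $(x)_{n,\mu}=\sum_{k=0}^{n}S_{2,\mu}(n,k)(x)_{k}$. Degenerate Whitney numbers of the second kind $W_{m,\lambda}(n,k)$: $(mx+1)_{n,\lambda}=\sum_{k=0}^{n}W_{m,\lambda}(n,k)m^{k}(x)_{k}$. -}

module Defs where

open import Level using (Level; _⊔_)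
open import Data.Nat as ℕ using (ℕ; zero; suc; _≤_; _∸_)
open import Data.Nat.Combinatorics using (_C_)
open import Data.Product using (∃)
open import Relation.Nullary using (¬_)
open import Algebra.Bundles using (CommutativeRing)

ι : ∀ {c ℓ} (R : CommutativeRing c ℓ) → ℕ → CommutativeRing.Carrier R
ι R zero    = CommutativeRing.0# R
ι R (suc n) = CommutativeRing._+_ R (CommutativeRing.1# R) (ι R n)

-- A field of characteristic zero: a commutative ring in which every nonzero
-- element is invertible and n·1 ≉ 0 for every positive integer n.
-- (The real numbers ℝ, which the paper uses, are such a field.)
record Char0Field (c ℓ : Level) : Set (Level.suc (c ⊔ ℓ)) where
  field
    cring : CommutativeRing c ℓ
  open CommutativeRing cring
  field
    inverse : ∀ x → ¬ (x ≈ 0#) → ∃ λ y → x * y ≈ 1#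
    char0   : ∀ n → ¬ (ι cring (suc n) ≈ 0#)

module _ {c ℓ} (F : Char0Field c ℓ) where
  open Char0Field F using (cring)
  open CommutativeRing cring

  ιF : ℕ → Carrier
  ιF = ι cring

  pow : Carrier → ℕ → Carrier
  pow x zero    = 1#
  pow x (suc n) = x * pow x n

  -- degenerate falling factorial (x)_{n,μ} = x (x - μ) ... (x - (n-1)μ)
  ff : Carrier → ℕ → Carrier → Carrier
  ff μ zero    x = 1#
  ff μ (suc n) x = ff μ n x * (x - ιF n * μ)

  ff1 : ℕ → Carrier → Carrier
  ff1 n x = ff 1# n x

  sumTo : ℕ → (ℕ → Carrier) → Carrier
  sumTo zero    f = f 0
  sumTo (suc n) f = sumTo n f + f (suc n)

  -- Σ_{i=a}^{n} f i  (used only with a ≤ n): Σ_{j=0}^{n-a} f (a + j)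
  sumFromTo : ℕ → ℕ → (ℕ → Carrier) → Carrier
  sumFromTo a n f = sumTo (n ∸ a) (λ j → f (a ℕ.+ j))

  -- S is the array of degenerate Stirling numbers of the second kind with
  -- parameter μ:  (x)_{n,μ} = Σ_{k=0}^{n} S(n,k) (x)_k  for all x.
  IsDegStirling2 : Carrier → (ℕ → ℕ → Carrier) → Set (c ⊔ ℓ)
  IsDegStirling2 μ S = ∀ n x → ff μ n x ≈ sumTo n (λ k → S n k * ff1 k x)

  -- W is the array of degenerate Whitney numbers of the second kind with
  -- parameters m, λ:  (mx+1)_{n,λ} = Σ_{k=0}^{n} W(n,k) m^k (x)_k  for all x.
  IsDegWhitney2 : ℕ → Carrier → (ℕ → ℕ → Carrier) → Set (c ⊔ ℓ)
  IsDegWhitney2 m lam W =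
    ∀ n x → ff lam n (ιF m * x + 1#) ≈ sumTo n (λ k → W n k * pow (ιF m) k * ff1 k x)

-- Expand (m x + 1)_{n,λ} by the degenerate Vandermonde identity
-- (x + y)_{n,λ} = Σ_i C(n,i) (x)_{i,λ} (y)_{n-i,λ} with y = 1.  Scaling gives
-- (m x)_{i,λ} = m^i (x)_{i,λ/m}, and the latter expands in the ordinary falling
-- factorials with the coefficients S_{2,λ/m}(i,k).  After exchanging the two sums,
-- the coefficient of (x)_k is m^k times the claimed sum.  Since (k)_j vanishes for
-- j > k and not for j = k in characteristic zero, the (x)_k are linearly
-- independent as functions, so this coefficient equals W_{m,λ}(n,k) m^k; cancel m^k.
module Submission where

open import Defs
open import Data.Nat as ℕ using (ℕ; zero; suc; _≤_; _<_; _∸_; z≤n; s≤s)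
import Data.Nat.Properties as ℕP
open import Data.Nat.Combinatorics using (_C_; nCk+nC[k+1]≡[n+1]C[k+1]; k>n⇒nCk≡0)
open import Data.Nat.Induction using (<-rec)
open import Data.Product using (_,_)
open import Data.Sum using (inj₁; inj₂)
open import Relation.Binary.Definitions using (tri<; tri≈; tri>)
open import Relation.Nullary using (¬_; contradiction)
open import Relation.Binary.PropositionalEquality as ≡ using (_≡_; _≢_)
open import Algebra.Bundles using (CommutativeRing)

module _ {c ℓ} (F : Char0Field c ℓ) where
  open Char0Field F
  open CommutativeRing cring
  open import Relation.Binary.Reasoning.Setoid setoid
  open import Algebra.Properties.Ring ring using (x[y-z]≈xy-xz; [y-z]x≈yx-zx)
  open import Algebra.Properties.Group +-group using (x∙y⁻¹≈ε⇒x≈y)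
  open import Algebra.Properties.AbelianGroup +-abelianGroup using (⁻¹-∙-comm; xyx⁻¹≈y)
  open import Algebra.Properties.CommutativeSemigroup +-commutativeSemigroup
    using (interchange; x∙yz≈y∙xz)
  open import Algebra.Properties.CommutativeSemigroup *-commutativeSemigroup
    using () renaming (x∙yz≈y∙xz to x*yz≈y*xz)
  open import Algebra.Solver.Ring.NaturalCoefficients.Default commutativeSemiring

  private
    ι′ : ℕ → Carrier
    ι′ = ι cring

    ∑ : ℕ → (ℕ → Carrier) → Carrier
    ∑ = sumTo F

    infixr 8 _^_
    _^_ : Carrier → ℕ → Carrier
    _^_ = pow F

    fall : Carrier → ℕ → Carrier → Carrier
    fall = ff F

  sumTo-cong : ∀ n {f g} → (∀ {k} → k ≤ n → f k ≈ g k) → ∑ n f ≈ ∑ n g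
  sumTo-cong zero    f≈g = f≈g z≤n
  sumTo-cong (suc n) f≈g =
    +-cong (sumTo-cong n (λ k≤n → f≈g (ℕP.m≤n⇒m≤1+n k≤n))) (f≈g ℕP.≤-refl)

  sumTo-≡ : ∀ {a b} f → a ≡ b → ∑ a f ≈ ∑ b f
  sumTo-≡ f ≡.refl = refl

  sumTo-+ : ∀ n f g → ∑ n (λ k → f k + g k) ≈ ∑ n f + ∑ n g
  sumTo-+ zero    f g = refl
  sumTo-+ (suc n) f g = trans (+-congʳ (sumTo-+ n f g)) (interchange _ _ _ _)

  sumTo-minus : ∀ n f g → ∑ n (λ k → f k - g k) ≈ ∑ n f - ∑ n g
  sumTo-minus zero    f g = refl
  sumTo-minus (suc n) f g = begin
    ∑ n (λ k → f k - g k) + (f (suc n) - g (suc n))  ≈⟨ +-congʳ (sumTo-minus n f g) ⟩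
    (∑ n f - ∑ n g) + (f (suc n) - g (suc n))        ≈⟨ interchange _ _ _ _ ⟩
    (∑ n f + f (suc n)) + (- ∑ n g - g (suc n))      ≈⟨ +-congˡ (⁻¹-∙-comm _ _) ⟩
    (∑ n f + f (suc n)) - (∑ n g + g (suc n))        ∎

  *-distribˡ-sumTo : ∀ x n f → x * ∑ n f ≈ ∑ n (λ k → x * f k)
  *-distribˡ-sumTo x zero    f = refl
  *-distribˡ-sumTo x (suc n) f = trans (distribˡ x _ _) (+-congʳ (*-distribˡ-sumTo x n f))

  *-distribʳ-sumTo : ∀ x n f → ∑ n f * x ≈ ∑ n (λ k → f k * x)
  *-distribʳ-sumTo x zero    f = refl
  *-distribʳ-sumTo x (suc n) f = trans (distribʳ x _ _) (+-congʳ (*-distribʳ-sumTo x n f))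

  sumTo-suc-head : ∀ n f → ∑ (suc n) f ≈ f 0 + ∑ n (λ k → f (suc k))
  sumTo-suc-head zero    f = refl
  sumTo-suc-head (suc n) f = trans (+-congʳ (sumTo-suc-head n f)) (+-assoc _ _ _)

  sumTo-zero : ∀ n f → (∀ {k} → k ≤ n → f k ≈ 0#) → ∑ n f ≈ 0#
  sumTo-zero zero    f f≈0 = f≈0 z≤n
  sumTo-zero (suc n) f f≈0 =
    trans (+-cong (sumTo-zero n f (λ k≤n → f≈0 (ℕP.m≤n⇒m≤1+n k≤n))) (f≈0 ℕP.≤-refl))
          (+-identityˡ 0#)

  sumTo-single : ∀ n f {k} → k ≤ n → (∀ {j} → j ≤ n → j ≢ k → f j ≈ 0#) → ∑ n f ≈ f k
  sumTo-single zero    f z≤n others = refl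
  sumTo-single (suc n) f {k} k≤1+n others with ℕP.m≤n⇒m<n∨m≡n k≤1+n
  ... | inj₁ (s≤s k≤n) =
    trans (+-cong (sumTo-single n f k≤n (λ j≤n → others (ℕP.m≤n⇒m≤1+n j≤n)))
                  (others ℕP.≤-refl (ℕP.>⇒≢ (s≤s k≤n))))
          (+-identityʳ (f k))
  ... | inj₂ ≡.refl =
    trans (+-congʳ (sumTo-zero n f (λ j≤n → others (ℕP.m≤n⇒m≤1+n j≤n) (ℕP.<⇒≢ (s≤s j≤n)))))
          (+-identityˡ _)

  sumTo-exchange : ∀ n (g : ℕ → ℕ → Carrier) →
    ∑ n (λ i → ∑ i (g i)) ≈ ∑ n (λ k → ∑ (n ∸ k) (λ j → g (k ℕ.+ j) k))
  sumTo-exchange zero    g = refl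
  sumTo-exchange (suc n) g = begin
    ∑ n (λ i → ∑ i (g i)) + ∑ (suc n) (g (suc n))
      ≈⟨ +-congʳ (sumTo-exchange n g) ⟩
    ∑ n (column n) + (∑ n (g (suc n)) + g (suc n) (suc n))
      ≈⟨ +-assoc _ _ _ ⟨
    (∑ n (column n) + ∑ n (g (suc n))) + g (suc n) (suc n)
      ≈⟨ +-cong (sym (sumTo-+ n _ _)) diagonal ⟩
    ∑ n (λ k → column n k + g (suc n) k) + column (suc n) (suc n)
      ≈⟨ +-congʳ (sumTo-cong n extend) ⟩
    ∑ n (column (suc n)) + column (suc n) (suc n)
      ∎
    where
    column : ℕ → ℕ → Carrier
    column m k = ∑ (m ∸ k) (λ j → g (k ℕ.+ j) k)

    diagonal : g (suc n) (suc n) ≈ column (suc n) (suc n)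
    diagonal = sym (trans (sumTo-≡ _ (ℕP.n∸n≡0 n))
                          (reflexive (≡.cong (λ i → g i (suc n)) (ℕP.+-identityʳ (suc n)))))

    extend : ∀ {k} → k ≤ n → column n k + g (suc n) k ≈ column (suc n) k
    extend {k} k≤n = sym (trans (sumTo-≡ _ (ℕP.+-∸-assoc 1 k≤n))
      (+-congˡ (reflexive (≡.cong (λ i → g i k)
        (≡.trans (ℕP.+-suc k (n ∸ k)) (≡.cong suc (ℕP.m+[n∸m]≡n k≤n)))))))

  *-cancelʳ-nonzero : ∀ {p} a b → ¬ p ≈ 0# → a * p ≈ b * p → a ≈ b
  *-cancelʳ-nonzero {p} a b p≉0 ap≈bp with inverse p p≉0
  ... | q , pq≈1 = begin
    a            ≈⟨ *-identityʳ a ⟨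
    a * 1#       ≈⟨ *-congˡ pq≈1 ⟨
    a * (p * q)  ≈⟨ *-assoc a p q ⟨
    (a * p) * q  ≈⟨ *-congʳ ap≈bp ⟩
    (b * p) * q  ≈⟨ *-assoc b p q ⟩
    b * (p * q)  ≈⟨ *-congˡ pq≈1 ⟩
    b * 1#       ≈⟨ *-identityʳ b ⟩
    b            ∎

  *-nonzero : ∀ {a b} → ¬ a ≈ 0# → ¬ b ≈ 0# → ¬ a * b ≈ 0#
  *-nonzero {a} {b} a≉0 b≉0 ab≈0 =
    b≉0 (*-cancelʳ-nonzero b 0# a≉0 (trans (*-comm b a) (trans ab≈0 (sym (zeroˡ a)))))

  ι-+ : ∀ a b → ι′ (a ℕ.+ b) ≈ ι′ a + ι′ b
  ι-+ zero    b = sym (+-identityˡ _)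
  ι-+ (suc a) b = trans (+-congˡ (ι-+ a b)) (sym (+-assoc _ _ _))

  ι-∸ : ∀ {a b} → a ≤ b → ι′ b - ι′ a ≈ ι′ (b ∸ a)
  ι-∸ {a} {b} a≤b = begin
    ι′ b - ι′ a                    ≈⟨ +-congʳ (reflexive (≡.cong ι′ (ℕP.m+[n∸m]≡n a≤b))) ⟨
    ι′ (a ℕ.+ (b ∸ a)) - ι′ a      ≈⟨ +-congʳ (ι-+ a (b ∸ a)) ⟩
    ι′ a + ι′ (b ∸ a) - ι′ a       ≈⟨ xyx⁻¹≈y _ _ ⟩
    ι′ (b ∸ a)                     ∎

  ι-nonzero : ∀ {n} → 0 < n → ¬ ι′ n ≈ 0#
  ι-nonzero {suc n} _ = char0 n

  1≉0 : ¬ 1# ≈ 0#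
  1≉0 1≈0 = ι-nonzero {1} (s≤s z≤n) (trans (+-identityʳ 1#) 1≈0)

  pow-+ : ∀ x a b → x ^ (a ℕ.+ b) ≈ x ^ a * x ^ b
  pow-+ x zero    b = sym (*-identityˡ _)
  pow-+ x (suc a) b = trans (*-congˡ (pow-+ x a b)) (sym (*-assoc _ _ _))

  pow-nonzero : ∀ {x} → ¬ x ≈ 0# → ∀ k → ¬ x ^ k ≈ 0#
  pow-nonzero x≉0 zero    = 1≉0
  pow-nonzero x≉0 (suc k) = *-nonzero x≉0 (pow-nonzero x≉0 k)

  fall-ι-factor : ∀ {j k} → j ≤ k → ι′ k - ι′ j * 1# ≈ ι′ (k ∸ j)
  fall-ι-factor j≤k = trans (+-congˡ (-‿cong (*-identityʳ _))) (ι-∸ j≤k)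

  fall-ι-vanish : ∀ {k j} → k < j → fall 1# j (ι′ k) ≈ 0#
  fall-ι-vanish {k} {suc j} k<1+j with ℕP.m≤n⇒m<n∨m≡n (ℕP.≤-pred k<1+j)
  ... | inj₁ k<j   = trans (*-congʳ (fall-ι-vanish k<j)) (zeroˡ _)
  ... | inj₂ ≡.refl =
    trans (*-congˡ (trans (fall-ι-factor {k} ℕP.≤-refl) (reflexive (≡.cong ι′ (ℕP.n∸n≡0 k)))))
          (zeroʳ _)

  fall-ι-nonzero : ∀ {j k} → j ≤ k → ¬ fall 1# j (ι′ k) ≈ 0#
  fall-ι-nonzero {zero}  _   = 1≉0
  fall-ι-nonzero {suc j} j<k = *-nonzero (fall-ι-nonzero (ℕP.<⇒≤ j<k))
    (λ factor≈0 → ι-nonzero (ℕP.m<n⇒0<n∸m j<k) (trans (sym (fall-ι-factor (ℕP.<⇒≤ j<k))) factor≈0))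

  fall-coefficients-zero : ∀ n (c : ℕ → Carrier) →
    (∀ x → ∑ n (λ j → c j * fall 1# j x) ≈ 0#) → ∀ {k} → k ≤ n → c k ≈ 0#
  fall-coefficients-zero n c vanishes {k} = <-rec (λ k → k ≤ n → c k ≈ 0#) step k
    where
    step : ∀ k → (∀ {j} → j < k → j ≤ n → c j ≈ 0#) → k ≤ n → c k ≈ 0#
    step k below k≤n = *-cancelʳ-nonzero (c k) 0# (fall-ι-nonzero {k} ℕP.≤-refl) (begin
      c k * fall 1# k (ι′ k)               ≈⟨ sumTo-single n _ k≤n others ⟨
      ∑ n (λ j → c j * fall 1# j (ι′ k))   ≈⟨ vanishes (ι′ k) ⟩
      0#                                   ≈⟨ zeroˡ _ ⟨
      0# * fall 1# k (ι′ k)                ∎)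
      where
      others : ∀ {j} → j ≤ n → j ≢ k → c j * fall 1# j (ι′ k) ≈ 0#
      others {j} j≤n j≢k with ℕP.<-cmp j k
      ... | tri< j<k _ _ = trans (*-congʳ (below j<k j≤n)) (zeroˡ _)
      ... | tri≈ _ j≡k _ = contradiction j≡k j≢k
      ... | tri> _ _ k<j = trans (*-congˡ (fall-ι-vanish k<j)) (zeroʳ _)

  fall-coefficients-unique : ∀ n (a b : ℕ → Carrier) →
    (∀ x → ∑ n (λ j → a j * fall 1# j x) ≈ ∑ n (λ j → b j * fall 1# j x)) →
    ∀ {k} → k ≤ n → a k ≈ b k
  fall-coefficients-unique n a b same k≤n =
    x∙y⁻¹≈ε⇒x≈y _ _ (fall-coefficients-zero n (λ j → a j - b j) difference k≤n)
    where
    difference : ∀ x → ∑ n (λ j → (a j - b j) * fall 1# j x) ≈ 0#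
    difference x = begin
      ∑ n (λ j → (a j - b j) * fall 1# j x)
        ≈⟨ sumTo-cong n (λ {j} _ → [y-z]x≈yx-zx _ (a j) (b j)) ⟩
      ∑ n (λ j → a j * fall 1# j x - b j * fall 1# j x)
        ≈⟨ sumTo-minus n _ _ ⟩
      ∑ n (λ j → a j * fall 1# j x) - ∑ n (λ j → b j * fall 1# j x)
        ≈⟨ +-congʳ (same x) ⟩
      ∑ n (λ j → b j * fall 1# j x) - ∑ n (λ j → b j * fall 1# j x)
        ≈⟨ -‿inverseʳ _ ⟩
      0# ∎

  fall-step-split : ∀ μ x y {i n} → i ≤ n →
    (x + y) - ι′ n * μ ≈ (x - ι′ i * μ) + (y - ι′ (n ∸ i) * μ)
  fall-step-split μ x y {i} {n} i≤n = begin
    (x + y) - ι′ n * μ                          ≈⟨ +-congˡ (-‿cong (*-congʳ ι-n)) ⟩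
    (x + y) - (ι′ i + ι′ (n ∸ i)) * μ           ≈⟨ +-congˡ (-‿cong (distribʳ μ _ _)) ⟩
    (x + y) - (ι′ i * μ + ι′ (n ∸ i) * μ)       ≈⟨ +-congˡ (⁻¹-∙-comm _ _) ⟨
    (x + y) + (- (ι′ i * μ) - ι′ (n ∸ i) * μ)   ≈⟨ interchange _ _ _ _ ⟩
    (x - ι′ i * μ) + (y - ι′ (n ∸ i) * μ)       ∎
    where
    ι-n : ι′ n ≈ ι′ i + ι′ (n ∸ i)
    ι-n = trans (reflexive (≡.cong ι′ (≡.sym (ℕP.m+[n∸m]≡n i≤n)))) (ι-+ i (n ∸ i))

  fall-binomial : ∀ μ x y n →
    fall μ n (x + y) ≈ ∑ n (λ i → ι′ (n C i) * fall μ i x * fall μ (n ∸ i) y)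
  fall-binomial μ x y zero    = sym (trans (*-identityʳ _) (trans (*-identityʳ _) (+-identityʳ 1#)))
  fall-binomial μ x y (suc n) = begin
    fall μ n (x + y) * ((x + y) - ι′ n * μ)             ≈⟨ *-congʳ (fall-binomial μ x y n) ⟩
    ∑ n (term n) * ((x + y) - ι′ n * μ)                 ≈⟨ *-distribʳ-sumTo _ n (term n) ⟩
    ∑ n (λ i → term n i * ((x + y) - ι′ n * μ))         ≈⟨ sumTo-cong n split ⟩
    ∑ n (λ i → raiseˡ i + raiseʳ i)                     ≈⟨ sumTo-+ n raiseˡ raiseʳ ⟩
    ∑ n raiseˡ + ∑ n raiseʳ                             ≈⟨ +-congˡ raiseʳ-head ⟩
    ∑ n raiseˡ + (raiseʳ 0 + ∑ n (λ i → raiseʳ (suc i))) ≈⟨ x∙yz≈y∙xz _ _ _ ⟩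
    raiseʳ 0 + (∑ n raiseˡ + ∑ n (λ i → raiseʳ (suc i))) ≈⟨ +-congˡ (sym (sumTo-+ n _ _)) ⟩
    raiseʳ 0 + ∑ n (λ i → raiseˡ i + raiseʳ (suc i))    ≈⟨ +-congˡ (sumTo-cong n (λ {i} _ → pascal i)) ⟩
    term (suc n) 0 + ∑ n (λ i → term (suc n) (suc i))   ≈⟨ sumTo-suc-head n (term (suc n)) ⟨
    ∑ (suc n) (term (suc n))                            ∎
    where
    term : ℕ → ℕ → Carrier
    term n i = ι′ (n C i) * fall μ i x * fall μ (n ∸ i) y

    raiseˡ raiseʳ : ℕ → Carrier
    raiseˡ i = ι′ (n C i) * fall μ (suc i) x * fall μ (n ∸ i) y
    raiseʳ i = ι′ (n C i) * fall μ i x * fall μ (suc n ∸ i) y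

    split : ∀ {i} → i ≤ n → term n i * ((x + y) - ι′ n * μ) ≈ raiseˡ i + raiseʳ i
    split {i} i≤n = begin
      term n i * ((x + y) - ι′ n * μ)
        ≈⟨ *-congˡ (fall-step-split μ x y i≤n) ⟩
      term n i * ((x - ι′ i * μ) + (y - ι′ (n ∸ i) * μ))
        ≈⟨ solve 5 (λ b a a′ p q → (b :* a :* a′) :* (p :+ q) := b :* (a :* p) :* a′ :+ b :* a :* (a′ :* q))
                   refl (ι′ (n C i)) (fall μ i x) (fall μ (n ∸ i) y) _ _ ⟩
      raiseˡ i + ι′ (n C i) * fall μ i x * fall μ (suc (n ∸ i)) y
        ≈⟨ +-congˡ (*-congˡ (reflexive (≡.cong (λ d → fall μ d y) (≡.sym (ℕP.+-∸-assoc 1 i≤n))))) ⟩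
      raiseˡ i + raiseʳ i ∎

    raiseʳ-head : ∑ n raiseʳ ≈ raiseʳ 0 + ∑ n (λ i → raiseʳ (suc i))
    raiseʳ-head = begin
      ∑ n raiseʳ                ≈⟨ +-identityʳ _ ⟨
      ∑ n raiseʳ + 0#           ≈⟨ +-congˡ raiseʳ-last ⟨
      ∑ (suc n) raiseʳ          ≈⟨ sumTo-suc-head n raiseʳ ⟩
      raiseʳ 0 + ∑ n (λ i → raiseʳ (suc i)) ∎
      where
      raiseʳ-last : raiseʳ (suc n) ≈ 0#
      raiseʳ-last = trans (*-congʳ (*-congʳ (reflexive (≡.cong ι′ (k>n⇒nCk≡0 (ℕP.n<1+n n))))))
                          (trans (*-congʳ (zeroˡ _)) (zeroˡ _))

    pascal : ∀ i → raiseˡ i + raiseʳ (suc i) ≈ term (suc n) (suc i)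
    pascal i = begin
      ι′ (n C i) * a * b + ι′ (n C suc i) * a * b   ≈⟨ distribʳ b _ _ ⟨
      (ι′ (n C i) * a + ι′ (n C suc i) * a) * b     ≈⟨ *-congʳ (distribʳ a _ _) ⟨
      (ι′ (n C i) + ι′ (n C suc i)) * a * b         ≈⟨ *-congʳ (*-congʳ (ι-+ (n C i) (n C suc i))) ⟨
      ι′ (n C i ℕ.+ n C suc i) * a * b              ≈⟨ *-congʳ (*-congʳ (reflexive (≡.cong ι′ (nCk+nC[k+1]≡[n+1]C[k+1] n i)))) ⟩
      term (suc n) (suc i)                          ∎
      where
      a b : Carrier
      a = fall μ (suc i) x
      b = fall μ (n ∸ i) y

  fall-scale : ∀ {M μ ν} → M * μ ≈ ν → ∀ i x → fall ν i (M * x) ≈ M ^ i * fall μ i x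
  fall-scale Mμ≈ν zero    x = sym (*-identityʳ 1#)
  fall-scale {M} {μ} {ν} Mμ≈ν (suc i) x = begin
    fall ν i (M * x) * (M * x - ι′ i * ν)                 ≈⟨ *-cong (fall-scale Mμ≈ν i x) factor ⟩
    (M ^ i * fall μ i x) * (M * (x - ι′ i * μ))           ≈⟨ solve 4 (λ P f M d → (P :* f) :* (M :* d) := (M :* P) :* (f :* d))
                                                                     refl (M ^ i) (fall μ i x) M _ ⟩
    (M * M ^ i) * (fall μ i x * (x - ι′ i * μ))           ∎
    where
    factor : M * x - ι′ i * ν ≈ M * (x - ι′ i * μ)
    factor = begin
      M * x - ι′ i * ν         ≈⟨ +-congˡ (-‿cong (*-congˡ Mμ≈ν)) ⟨
      M * x - ι′ i * (M * μ)   ≈⟨ +-congˡ (-‿cong (x*yz≈y*xz (ι′ i) M μ)) ⟩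
      M * x - M * (ι′ i * μ)   ≈⟨ x[y-z]≈xy-xz M x _ ⟨
      M * (x - ι′ i * μ)       ∎

  whitneyTerm : ℕ → Carrier → (ℕ → ℕ → Carrier) → ℕ → ℕ → ℕ → Carrier
  whitneyTerm m lam S n k i = ι′ (n C i) * ι′ m ^ (i ∸ k) * fall lam (n ∸ i) 1# * S i k

  whitney-expansion : ∀ m {lam lam/m S} → ι′ m * lam/m ≈ lam → IsDegStirling2 F lam/m S →
    ∀ n x → fall lam n (ι′ m * x + 1#) ≈
            ∑ n (λ k → ι′ m ^ k * sumFromTo F k n (whitneyTerm m lam S n k) * fall 1# k x)
  whitney-expansion m {lam} {lam/m} {S} scale stirling n x = begin
    fall lam n (M * x + 1#)
      ≈⟨ fall-binomial lam (M * x) 1# n ⟩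
    ∑ n (λ i → ι′ (n C i) * fall lam i (M * x) * fall lam (n ∸ i) 1#)
      ≈⟨ sumTo-cong n (λ {i} _ → expand i) ⟩
    ∑ n (λ i → ∑ i (λ k → coeff i k * fall 1# k x))
      ≈⟨ sumTo-exchange n (λ i k → coeff i k * fall 1# k x) ⟩
    ∑ n (λ k → ∑ (n ∸ k) (λ j → coeff (k ℕ.+ j) k * fall 1# k x))
      ≈⟨ sumTo-cong n (λ {k} _ → collect k) ⟩
    ∑ n (λ k → M ^ k * sumFromTo F k n (whitneyTerm m lam S n k) * fall 1# k x) ∎
    where
    M : Carrier
    M = ι′ m

    coeff : ℕ → ℕ → Carrier
    coeff i k = ι′ (n C i) * M ^ i * fall lam (n ∸ i) 1# * S i k

    expand : ∀ i → ι′ (n C i) * fall lam i (M * x) * fall lam (n ∸ i) 1# ≈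
                   ∑ i (λ k → coeff i k * fall 1# k x)
    expand i = begin
      ι′ (n C i) * fall lam i (M * x) * fall lam (n ∸ i) 1#
        ≈⟨ *-congʳ (*-congˡ (trans (fall-scale scale i x) (*-congˡ (stirling i x)))) ⟩
      ι′ (n C i) * (M ^ i * ∑ i (λ k → S i k * fall 1# k x)) * fall lam (n ∸ i) 1#
        ≈⟨ solve 4 (λ b p s a → b :* (p :* s) :* a := (b :* p :* a) :* s) refl _ _ _ _ ⟩
      (ι′ (n C i) * M ^ i * fall lam (n ∸ i) 1#) * ∑ i (λ k → S i k * fall 1# k x)
        ≈⟨ *-distribˡ-sumTo _ i _ ⟩
      ∑ i (λ k → (ι′ (n C i) * M ^ i * fall lam (n ∸ i) 1#) * (S i k * fall 1# k x))
        ≈⟨ sumTo-cong i (λ _ → sym (*-assoc _ _ _)) ⟩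
      ∑ i (λ k → coeff i k * fall 1# k x) ∎

    collect : ∀ k → ∑ (n ∸ k) (λ j → coeff (k ℕ.+ j) k * fall 1# k x) ≈
                    M ^ k * sumFromTo F k n (whitneyTerm m lam S n k) * fall 1# k x
    collect k = begin
      ∑ (n ∸ k) (λ j → coeff (k ℕ.+ j) k * fall 1# k x)
        ≈⟨ *-distribʳ-sumTo _ (n ∸ k) _ ⟨
      ∑ (n ∸ k) (λ j → coeff (k ℕ.+ j) k) * fall 1# k x
        ≈⟨ *-congʳ (sumTo-cong (n ∸ k) (λ {j} _ → shift j)) ⟩
      ∑ (n ∸ k) (λ j → M ^ k * whitneyTerm m lam S n k (k ℕ.+ j)) * fall 1# k x
        ≈⟨ *-congʳ (*-distribˡ-sumTo _ (n ∸ k) _) ⟨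
      M ^ k * sumFromTo F k n (whitneyTerm m lam S n k) * fall 1# k x ∎
      where
      shift : ∀ j → coeff (k ℕ.+ j) k ≈ M ^ k * whitneyTerm m lam S n k (k ℕ.+ j)
      shift j = begin
        ι′ (n C (k ℕ.+ j)) * M ^ (k ℕ.+ j) * a * s
          ≈⟨ *-congʳ (*-congʳ (*-congˡ (pow-+ M k j))) ⟩
        ι′ (n C (k ℕ.+ j)) * (M ^ k * M ^ j) * a * s
          ≈⟨ solve 5 (λ b p q a s → b :* (p :* q) :* a :* s := p :* (b :* q :* a :* s)) refl _ _ _ _ _ ⟩
        M ^ k * (ι′ (n C (k ℕ.+ j)) * M ^ j * a * s)
          ≈⟨ *-congˡ (*-congʳ (*-congʳ (*-congˡ (reflexive (≡.cong (M ^_) (≡.sym (ℕP.m+n∸m≡n k j))))))) ⟩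
        M ^ k * whitneyTerm m lam S n k (k ℕ.+ j) ∎
        where
        a s : Carrier
        a = fall lam (n ∸ (k ℕ.+ j)) 1#
        s = S (k ℕ.+ j) k

theorem13 : ∀ {c ℓ} (F : Char0Field c ℓ) →
    let open CommutativeRing (Char0Field.cring F) in
    (m : ℕ) → 1 ≤ m →
    (lam : Carrier) → ¬ (lam ≈ 0#) →
    (lam/m : Carrier) → ι (Char0Field.cring F) m * lam/m ≈ lam →
    (S W : ℕ → ℕ → Carrier) →
    IsDegStirling2 F lam/m S →
    IsDegWhitney2 F m lam W →
    (n k : ℕ) → k ≤ n →
    W n k ≈ sumFromTo F k n (λ i →
      ι (Char0Field.cring F) (n C i) * pow F (ι (Char0Field.cring F) m) (i ∸ k)
        * ff F lam (n ∸ i) 1# * S i k)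
theorem13 F m 1≤m lam _ _ scale S W stirling whitney n k k≤n =
  *-cancelʳ-nonzero F _ _ (pow-nonzero F (ι-nonzero F 1≤m) k)
    (trans (fall-coefficients-unique F n _ _ same-polynomial k≤n) (*-comm _ _))
  where
  open Char0Field F using (cring)
  open CommutativeRing cring

  same-polynomial : ∀ x →
    sumTo F n (λ j → W n j * pow F (ι cring m) j * ff1 F j x) ≈
    sumTo F n (λ j → pow F (ι cring m) j * sumFromTo F j n (whitneyTerm F m lam S n j) * ff1 F j x)
  same-polynomial x = trans (sym (whitney n x)) (whitney-expansion F m scale stirling n x)
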